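{- Let $\Sigma$ be a finite alphabet, fix a monoid homomorphism $\beta:\Sigma^*\to\{0,1\}^*$ (a binary code of the letters), and let $f:\mathbb{N}\to\Sigma^*$ be a prefix advice function (i.e. $f(n)$ is a prefix of $f(n+1)$ for all $n$). Let $\mu(f)\in[0,1]$ be the coding of $f$ defined in the context. Then for every $n\in\mathbb{N}$ and every integer $k$ with $k/2^n\in(0,1)$, $$\left|\mu(f)-\frac{k}{2^n}\right|>\frac{1}{2^{n+5}}.$$
   Context: For a word $a\in\Sigma^*$, let $c(a)\in\{0,1\}^*$ be obtained from the binary word $\beta(a)$ by replacing every $0$ by $100$ and every $1$ by $010$ (so $c$ of the empty word is empty). For a prefix function $f$ write $f(n+1)=f(n)s_{n+1}$ with $s_{n+1}\in\Sigma^*$. Define finite binary words $\mu(f)(n)$ by $\mu(f)(0)=c(f(0))$ and, for $n\ge 0$, $\mu(f)(n+1)=\mu(f)(n)\,c(s_{n+1})$ if $n+1$ is not a power of $2$, and $\mu(f)(n+1)=\mu(f)(n)\,c(s_{n+1})\,001$ if $n+1$ is a power of $2$ (powers of $2$ are $1,2,4,8,\dots$). Each $\mu(f)(n)$ is a prefix of $\mu(f)(n+1)$, and the limit is an infinite binary sequence $b_1b_2b_3\dots$; $\mu(f)$ is the real number $\sum_{i\ge1}b_i2^{ -i}$ (i.e. the number with binary expansion $0.b_1b_2b_3\dots$). -}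

module Defs where

open import Data.Bool using (Bool; true; false; if_then_else_)
open import Data.Nat using (ℕ; zero; suc; _^_; _≡ᵇ_)
open import Data.Integer using (ℤ)
open import Data.List using (List; []; _∷_; _++_; drop; length; concatMap; upTo)
open import Data.Bool.ListAction using (any)
open import Data.Product using (∃; Σ)
open import Data.Sum using (_⊎_)
open import Relation.Binary.PropositionalEquality using (_≡_)
open import Data.Rational using (ℚ; 0ℚ; 1ℚ; ½; _+_; _-_; _*_; _<_; _/_)

IsPrefix : {A : Set} → List A → List A → Set
IsPrefix {A} u v = ∃ λ (s : List A) → u ++ s ≡ v

-- β is a monoid homomorphism Σ* → {0,1}*   (false = 0, true = 1)
IsMonoidHom : {A : Set} → (List A → List Bool) → Set
IsMonoidHom β = (β [] ≡ []) Data.Product.× (∀ u v → β (u ++ v) ≡ β u ++ β v)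

c : List Bool → List Bool
c = concatMap (λ b → if b then false ∷ true ∷ false ∷ [] else true ∷ false ∷ false ∷ [])

isPow2 : ℕ → Bool
isPow2 n = any (λ i → (2 ^ i) ≡ᵇ n) (upTo (suc n))

-- s_{n+1}: f(n+1) = f(n) s_{n+1}
sufx : {A : Set} → (ℕ → List A) → ℕ → List A
sufx f n = drop (length (f n)) (f (suc n))

muW : {A : Set} → (List A → List Bool) → (ℕ → List A) → ℕ → List Bool
muW β f zero = c (β (f zero))
muW β f (suc n) = muW β f n ++ (c (β (sufx f n)) ++
  (if isPow2 (suc n) then false ∷ false ∷ true ∷ [] else []))

val : List Bool → ℚ
val [] = 0ℚ
val (b ∷ w) = ½ * ((if b then 1ℚ else 0ℚ) + val w)

inv2^ : ℕ → ℚ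
inv2^ zero = 1ℚ
inv2^ (suc n) = ½ * inv2^ n

-- The real x = lim_N 0.(w N), for an increasing chain of prefixes w N whose
-- lengths tend to infinity.  Strict comparisons of x with rationals:
-- q < x  iff some approximation 0.(w N) exceeds q;
-- x < q  iff some upper bound 0.(w N) + 2^{-|w N|} is below q.
RealGt : (ℕ → List Bool) → ℚ → Set
RealGt w q = ∃ λ N → q < val (w N)

RealLt : (ℕ → List Bool) → ℚ → Set
RealLt w q = ∃ λ N → val (w N) + inv2^ (length (w N)) < q

DistGt : (ℕ → List Bool) → ℚ → ℚ → Set
DistGt w r ε = RealGt w (r + ε) ⊎ RealLt w (r - ε)

dyadic : ℤ → ℕ → ℚ
dyadic k n = (k / 1) * inv2^ n

-- The word μ(f)(2^(n+9)) has at least n + 9 bits and is a concatenation of the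
-- blocks 100, 010, 001.  Cut it after n bits: the rest g starts inside a block
-- and continues with two whole blocks, so every real with an expansion
-- extending g lies strictly between 2⁻⁵ and 1 − 2⁻⁵.  Reading the first n bits
-- one at a time and replacing r by 2r − b scales the distance to r by 2 at each
-- step, and after n steps r is an integer, hence ≤ 0 or ≥ 1.

module Submission where

open import Defs

module BinaryFractions where

  open import Data.Bool using (Bool; true; false; if_then_else_)
  open import Data.Integer as ℤ using (+_; +[1+_]; -[1+_])
  import Data.Integer.Properties as ℤ
  open import Data.List using (List; []; _∷_; _++_; length)
  open import Data.Nat as ℕ using (ℕ; zero; suc)
  open import Data.Product using (_×_; _,_; ∃)
  open import Relation.Nullary using (Dec)
  open import Relation.Nullary.Decidable using (_×-dec_)
  open import Data.Rational using (ℚ; 0ℚ; 1ℚ; ½; _<_; _+_; _-_; _*_; _≤_; _/_; toℚᵘ)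
  open import Data.Rational.Properties
    using (≤-refl; <-≤-trans; ≤-<-trans; _<?_; +-mono-≤; +-monoˡ-≤; +-monoʳ-≤; +-monoʳ-<;
           +-identityʳ; *-identityʳ; *-monoˡ-≤-nonNeg; *-monoʳ-<-pos;
           toℚᵘ-injective; toℚᵘ-cancel-≤; toℚᵘ-fromℚᵘ; toℚᵘ-homo-+)
  open import Data.Rational.Solver using (module +-*-Solver)
  import Data.Rational.Unnormalised as ℚᵘ
  import Data.Rational.Unnormalised.Properties as ℚᵘ
  open import Data.Sum using (_⊎_; inj₁; inj₂)
  open import Relation.Binary.PropositionalEquality using (_≡_; refl; sym; cong; subst; subst₂)
  open +-*-Solver

  bit : Bool → ℚ
  bit b = if b then 1ℚ else 0ℚ

  val⁺ : List Bool → ℚ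
  val⁺ w = val w + inv2^ (length w)

  ½*-mono-≤ : ∀ {p q} → p ≤ q → ½ * p ≤ ½ * q
  ½*-mono-≤ = *-monoˡ-≤-nonNeg ½

  ½*-mono-< : ∀ {p q} → p < q → ½ * p < ½ * q
  ½*-mono-< = *-monoʳ-<-pos ½

  val⁺-∷ : ∀ b w → val⁺ (b ∷ w) ≡ ½ * (bit b + val⁺ w)
  val⁺-∷ b w = solve 4 (λ h x v e → h :* (x :+ v) :+ h :* e := h :* (x :+ (v :+ e)))
    refl ½ (bit b) (val w) (inv2^ (length w))

  0≤bit : ∀ b → 0ℚ ≤ bit b
  0≤bit true = toℚᵘ-cancel-≤ (ℚᵘ.*≤* (ℤ.+≤+ ℕ.z≤n))
  0≤bit false = ≤-refl

  bit≤1 : ∀ b → bit b ≤ 1ℚ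
  bit≤1 true = ≤-refl
  bit≤1 false = toℚᵘ-cancel-≤ (ℚᵘ.*≤* (ℤ.+≤+ ℕ.z≤n))

  0≤val : ∀ w → 0ℚ ≤ val w
  0≤val [] = ≤-refl
  0≤val (b ∷ w) = ½*-mono-≤ (+-mono-≤ (0≤bit b) (0≤val w))

  val-++ : ∀ u w → val u ≤ val (u ++ w)
  val-++ [] w = 0≤val w
  val-++ (b ∷ u) w = ½*-mono-≤ (+-monoʳ-≤ (bit b) (val-++ u w))

  ½*[1+1]≡1 : ½ * (1ℚ + 1ℚ) ≡ 1ℚ
  ½*[1+1]≡1 = refl

  val⁺≤1 : ∀ w → val⁺ w ≤ 1ℚ
  val⁺≤1 [] = ≤-refl
  val⁺≤1 (b ∷ w) =
    subst₂ _≤_ (sym (val⁺-∷ b w)) ½*[1+1]≡1 (½*-mono-≤ (+-mono-≤ (bit≤1 b) (val⁺≤1 w)))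

  val⁺-++ : ∀ u w → val⁺ (u ++ w) ≤ val⁺ u
  val⁺-++ [] w = val⁺≤1 w
  val⁺-++ (b ∷ u) w =
    subst₂ _≤_ (sym (val⁺-∷ b (u ++ w))) (sym (val⁺-∷ b u))
      (½*-mono-≤ (+-monoʳ-≤ (bit b) (val⁺-++ u w)))

  toℚᵘ-/1 : ∀ k → toℚᵘ (k / 1) ℚᵘ.≃ ℚᵘ.mkℚᵘ k 0
  toℚᵘ-/1 k = toℚᵘ-fromℚᵘ (ℚᵘ.mkℚᵘ k 0)

  k/1-1≡[k-1]/1 : ∀ k → k / 1 - 1ℚ ≡ (k ℤ.- + 1) / 1
  k/1-1≡[k-1]/1 k = toℚᵘ-injective (begin
    toℚᵘ (k / 1 - 1ℚ)                    ≈⟨ toℚᵘ-homo-+ (k / 1) _ ⟩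
    toℚᵘ (k / 1) ℚᵘ.+ ℚᵘ.mkℚᵘ -[1+ 0 ] 0 ≈⟨ ℚᵘ.+-congˡ _ (toℚᵘ-/1 k) ⟩
    ℚᵘ.mkℚᵘ k 0 ℚᵘ.+ ℚᵘ.mkℚᵘ -[1+ 0 ] 0
      ≈⟨ ℚᵘ.*≡* (cong (λ i → (i ℤ.+ -[1+ 0 ]) ℤ.* + 1) (ℤ.*-identityʳ k)) ⟩
    ℚᵘ.mkℚᵘ (k ℤ.- + 1) 0                ≈⟨ ℚᵘ.≃-sym (toℚᵘ-/1 (k ℤ.- + 1)) ⟩
    toℚᵘ ((k ℤ.- + 1) / 1)               ∎)
    where open ℚᵘ.≃-Reasoning

  k/1≤0⊎1≤k/1 : ∀ k → k / 1 ≤ 0ℚ ⊎ 1ℚ ≤ k / 1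
  k/1≤0⊎1≤k/1 (+ 0) = inj₁ ≤-refl
  k/1≤0⊎1≤k/1 +[1+ m ] =
    inj₂ (toℚᵘ-cancel-≤ (ℚᵘ.≤-respʳ-≃ (ℚᵘ.≃-sym (toℚᵘ-/1 +[1+ m ])) (ℚᵘ.*≤* (ℤ.+≤+ (ℕ.s≤s ℕ.z≤n)))))
  k/1≤0⊎1≤k/1 -[1+ m ] =
    inj₁ (toℚᵘ-cancel-≤ (ℚᵘ.≤-respˡ-≃ (ℚᵘ.≃-sym (toℚᵘ-/1 -[1+ m ])) (ℚᵘ.*≤* ℤ.-≤+)))

  IsDyadic : ℕ → ℚ → Set
  IsDyadic zero r = ∃ λ k → r ≡ k / 1
  IsDyadic (suc n) r = IsDyadic n (r + r)

  dyadic-isDyadic : ∀ k n → IsDyadic n (dyadic k n)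
  dyadic-isDyadic k zero = k , *-identityʳ (k / 1)
  dyadic-isDyadic k (suc n) = subst (IsDyadic n) (sym double) (dyadic-isDyadic k n)
    where
    double : dyadic k (suc n) + dyadic k (suc n) ≡ dyadic k n
    double = solve 2 (λ a e → a :* (con ½ :* e) :+ a :* (con ½ :* e) := a :* e) refl (k / 1) (inv2^ n)

  isDyadic-minus-1 : ∀ n {r} → IsDyadic n r → IsDyadic n (r - 1ℚ)
  isDyadic-minus-1 zero (k , refl) = k ℤ.- + 1 , k/1-1≡[k-1]/1 k
  isDyadic-minus-1 (suc n) {r} d = subst (IsDyadic n) regroup (isDyadic-minus-1 n (isDyadic-minus-1 n d))
    where
    regroup : (r + r) - 1ℚ - 1ℚ ≡ (r - 1ℚ) + (r - 1ℚ)
    regroup = solve 1 (λ r → r :+ r :- con 1ℚ :- con 1ℚ := (r :- con 1ℚ) :+ (r :- con 1ℚ)) refl r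

  isDyadic-double-minus-bit : ∀ n {r} b → IsDyadic (suc n) r → IsDyadic n (r + r - bit b)
  isDyadic-double-minus-bit n true d = isDyadic-minus-1 n d
  isDyadic-double-minus-bit n {r} false d = subst (IsDyadic n) (sym (+-identityʳ (r + r))) d

  Apart : List Bool → ℚ → ℚ → Set
  Apart w r ε = r + ε < val w ⊎ val⁺ w < r - ε

  Separated : List Bool → Set
  Separated g = inv2^ 5 < val g × val⁺ g < 1ℚ - inv2^ 5

  separated? : ∀ g → Dec (Separated g)
  separated? g = (inv2^ 5 <? val g) ×-dec (val⁺ g <? 1ℚ - inv2^ 5)

  separated-++ : ∀ u w → Separated u → Separated (u ++ w)
  separated-++ u w (low , high) = <-≤-trans low (val-++ u w) , ≤-<-trans (val⁺-++ u w) high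

  separated-apart-integer : ∀ {g r} → Separated g → IsDyadic 0 r → Apart g r (inv2^ 5)
  separated-apart-integer (low , high) (k , refl) with k/1≤0⊎1≤k/1 k
  ... | inj₁ k≤0 = inj₁ (≤-<-trans (+-monoˡ-≤ (inv2^ 5) k≤0) low)
  ... | inj₂ 1≤k = inj₂ (<-≤-trans high (+-monoˡ-≤ _ 1≤k))

  apart-∷ : ∀ {w r ε} b → Apart w (r + r - bit b) ε → Apart (b ∷ w) r (½ * ε)
  apart-∷ {w} {r} {ε} b (inj₁ below) =
    inj₁ (subst (_< val (b ∷ w)) halve (½*-mono-< (+-monoʳ-< (bit b) below)))
    where
    halve : ½ * (bit b + ((r + r - bit b) + ε)) ≡ r + ½ * ε
    halve = solve 3 (λ x r e → con ½ :* (x :+ ((r :+ r :- x) :+ e)) := r :+ con ½ :* e) refl (bit b) r ε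
  apart-∷ {w} {r} {ε} b (inj₂ above) =
    inj₂ (subst₂ _<_ (sym (val⁺-∷ b w)) halve (½*-mono-< (+-monoʳ-< (bit b) above)))
    where
    halve : ½ * (bit b + ((r + r - bit b) - ε)) ≡ r - ½ * ε
    halve = solve 3 (λ x r e → con ½ :* (x :+ ((r :+ r :- x) :- e)) := r :- con ½ :* e) refl (bit b) r ε

  separated-apart : ∀ p {g r} → Separated g → IsDyadic (length p) r →
                    Apart (p ++ g) r (inv2^ (length p ℕ.+ 5))
  separated-apart [] {g} {r} sep d = separated-apart-integer {g} {r} sep d
  separated-apart (b ∷ p) {g} {r} sep d =
    apart-∷ {p ++ g} {r} {inv2^ (length p ℕ.+ 5)} b
      (separated-apart p {g} {r + r - bit b} sep (isDyadic-double-minus-bit (length p) {r} b d))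

module BlockWords where

  open import Data.Bool using (Bool; true; false; T)
  open import Data.Fin using (Fin; toℕ; _≟_)
  open import Data.Fin.Patterns using (0F; 1F; 2F)
  open import Data.Fin.Properties using (all?; toℕ<n)
  open import Data.List using (List; []; _∷_; _++_; length; take; drop; tabulate)
  open import Data.List.Properties
    using (++-assoc; length-++; length-++-≤ˡ; length-++-≤ʳ; length-take; take++drop≡id)
  open import Data.List.Membership.Propositional using (lose)
  open import Data.List.Membership.Propositional.Properties using (∈-upTo⁺)
  open import Data.List.Relation.Unary.Any.Properties using (any⁺)
  open import Data.Nat
    using (ℕ; zero; suc; _+_; _^_; pred; _≤_; _<_; z≤n; s≤s; _≤′_; ≤′-refl; ≤′-step)
  open import Data.Nat.Properties
    using (≤-refl; ≤-reflexive; ≤-trans; ≤-pred; <⇒≤; +-mono-≤; m≤m+n; m<m+n; ≤⇒≤′;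
           m+n≤o⇒m≤o; m+n≤o⇒n≤o; m≤n⇒m⊓n≡m; ≡⇒≡ᵇ; ^-monoʳ-<; <⇒≤pred; suc-pred; m^n≢0; m^n>0;
           n<1+n; module ≤-Reasoning)
  open import Relation.Binary.PropositionalEquality using (_≡_; refl; sym; trans; cong; subst; subst₂)
  open import Function using (_∘_)
  open import Relation.Nullary using (does)
  open import Relation.Nullary.Decidable using (from-yes)
  open BinaryFractions
    using (IsDyadic; Apart; Separated; separated?; separated-++; separated-apart)

  -- block 0F, 1F, 2F are 100, 010, 001 (the codes of 0 and 1 under c, and the
  -- separator); defining it by tabulate makes its length 3 definitional.
  block : Fin 3 → List Bool
  block i = tabulate (λ j → does (i ≟ j))

  data BlockWord : List Bool → Set where
    [] : BlockWord []
    _∷_ : ∀ x {w} → BlockWord w → BlockWord (block x ++ w)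

  blockWord-++ : ∀ {u w} → BlockWord u → BlockWord w → BlockWord (u ++ w)
  blockWord-++ [] bw = bw
  blockWord-++ {w = w} (_∷_ x {u} bu) bw =
    subst BlockWord (sym (++-assoc (block x) u w)) (x ∷ blockWord-++ bu bw)

  c-blockWord : ∀ u → BlockWord (c u)
  c-blockWord [] = []
  c-blockWord (true ∷ u) = 1F ∷ c-blockWord u
  c-blockWord (false ∷ u) = 0F ∷ c-blockWord u

  muW-blockWord : ∀ {A : Set} (β : List A → List Bool) f N → BlockWord (muW β f N)
  muW-blockWord β f zero = c-blockWord (β (f zero))
  muW-blockWord β f (suc N) with isPow2 (suc N)
  ... | true = blockWord-++ (muW-blockWord β f N) (blockWord-++ (c-blockWord (β (sufx f N))) (2F ∷ []))
  ... | false = blockWord-++ (muW-blockWord β f N) (blockWord-++ (c-blockWord (β (sufx f N))) [])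

  -- The first five bits of such a window contain a whole block, hence a 1 and
  -- a 0, and later bits contain another of each; the 81 cases are evaluated.
  separated-window : ∀ (i x y z : Fin 3) → Separated (drop (toℕ i) (block x ++ block y ++ block z))
  separated-window = from-yes (all? λ (i : Fin 3) → all? λ x → all? λ y → all? λ z →
    separated? (drop (toℕ i) (block x ++ block y ++ block z)))

  drop-++ˡ : ∀ {A : Set} n (u w : List A) → n ≤ length u → drop n (u ++ w) ≡ drop n u ++ w
  drop-++ˡ zero u w _ = refl
  drop-++ˡ (suc n) (x ∷ u) w (s≤s n≤|u|) = drop-++ˡ n u w n≤|u|

  separated-drop-<3 : ∀ (i : Fin 3) {w} → BlockWord w → 9 ≤ length w → Separated (drop (toℕ i) w)
  separated-drop-<3 i (x ∷ y ∷ z ∷ bw) _ =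
    subst Separated (sym (drop-++ˡ (toℕ i) window _ i≤9))
      (separated-++ (drop (toℕ i) window) _ (separated-window i x y z))
    where
    window : List Bool
    window = block x ++ block y ++ block z
    i≤9 : toℕ i ≤ 9
    i≤9 = ≤-trans (<⇒≤ (toℕ<n i)) (m≤m+n 3 6)
  separated-drop-<3 i (x ∷ []) (s≤s (s≤s (s≤s ())))
  separated-drop-<3 i (x ∷ y ∷ []) (s≤s (s≤s (s≤s (s≤s (s≤s (s≤s ()))))))

  separated-drop : ∀ n {w} → BlockWord w → n + 9 ≤ length w → Separated (drop n w)
  separated-drop 0 bw le = separated-drop-<3 0F bw le
  separated-drop 1 bw le = separated-drop-<3 1F bw (m+n≤o⇒n≤o 1 le)
  separated-drop 2 bw le = separated-drop-<3 2F bw (m+n≤o⇒n≤o 2 le)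
  separated-drop (suc (suc (suc n))) (x ∷ bw) le = separated-drop n bw (≤-pred (≤-pred (≤-pred le)))

  n<2^n : ∀ n → n < 2 ^ n
  n<2^n zero = s≤s z≤n
  n<2^n (suc n) = +-mono-≤ (m^n>0 2 n) (≤-trans (n<2^n n) (m≤m+n (2 ^ n) 0))

  isPow2-2^ : ∀ j → T (isPow2 (2 ^ j))
  isPow2-2^ j = any⁺ _ (lose (∈-upTo⁺ (s≤s (<⇒≤ (n<2^n j)))) (≡⇒≡ᵇ (2 ^ j) (2 ^ j) refl))

  module _ {A : Set} (β : List A → List Bool) (f : ℕ → List A) where

    length-muW-suc : ∀ N → length (muW β f N) ≤ length (muW β f (suc N))
    length-muW-suc N = length-++-≤ˡ (muW β f N)

    length-muW-mono : ∀ {N M} → N ≤′ M → length (muW β f N) ≤ length (muW β f M)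
    length-muW-mono ≤′-refl = ≤-refl
    length-muW-mono {M = suc M} (≤′-step N≤′M) =
      ≤-trans (length-muW-mono N≤′M) (length-muW-suc M)

    length-muW-pow2 : ∀ N → T (isPow2 (suc N)) → length (muW β f N) < length (muW β f (suc N))
    length-muW-pow2 N pow with isPow2 (suc N)
    ... | true = ≤-trans (m<m+n _ separator-nonempty) (≤-reflexive (sym (length-++ (muW β f N))))
      where
      separator-nonempty : 0 < length (c (β (sufx f N)) ++ false ∷ false ∷ true ∷ [])
      separator-nonempty = ≤-trans (s≤s z≤n) (length-++-≤ʳ (false ∷ false ∷ true ∷ []) {c (β (sufx f N))})

    length-muW-2^ : ∀ j → j ≤ length (muW β f (2 ^ j))
    length-muW-2^ zero = z≤n
    length-muW-2^ (suc j) = begin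
      suc j                           ≤⟨ s≤s (length-muW-2^ j) ⟩
      suc (length (muW β f (2 ^ j)))  ≤⟨ s≤s (length-muW-mono (≤⇒≤′ 2^j≤M)) ⟩
      suc (length (muW β f M))        ≤⟨ length-muW-pow2 M 2^1+j-isPow2 ⟩
      length (muW β f (suc M))        ≡⟨ cong (length ∘ muW β f) 1+M≡2^1+j ⟩
      length (muW β f (2 ^ suc j))    ∎
      where
      open ≤-Reasoning
      M : ℕ
      M = pred (2 ^ suc j)
      1+M≡2^1+j : suc M ≡ 2 ^ suc j
      1+M≡2^1+j = suc-pred (2 ^ suc j) {{m^n≢0 2 (suc j)}}
      2^1+j-isPow2 : T (isPow2 (suc M))
      2^1+j-isPow2 = subst (T ∘ isPow2) (sym 1+M≡2^1+j) (isPow2-2^ (suc j))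
      2^j≤M : 2 ^ j ≤ M
      2^j≤M = <⇒≤pred (^-monoʳ-< 2 (s≤s (s≤s z≤n)) (n<1+n j))

  blockWord-apart : ∀ n {w r} → BlockWord w → n + 9 ≤ length w → IsDyadic n r →
                    Apart w r (inv2^ (n + 5))
  blockWord-apart n {w} {r} bw n+9≤|w| d =
    subst₂ (λ m u → Apart u r (inv2^ (m + 5))) |take| (take++drop≡id n w)
      (separated-apart (take n w) (separated-drop n bw n+9≤|w|)
        (subst (λ m → IsDyadic m r) (sym |take|) d))
    where
    |take| : length (take n w) ≡ n
    |take| = trans (length-take n w) (m≤n⇒m⊓n≡m (m+n≤o⇒m≤o n n+9≤|w|))

open import Data.Bool using (Bool)
open import Data.Nat using (ℕ; suc; _+_; _^_)
open import Data.Integer using (ℤ)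
open import Data.Fin using (Fin)
open import Data.List using (List)
open import Data.Product using (_×_; _,_)
open import Data.Rational using (0ℚ; 1ℚ; _<_)
import Data.Sum as Sum
open BinaryFractions using (dyadic-isDyadic)
open BlockWords using (blockWord-apart; muW-blockWord; length-muW-2^)

mainTheorem1 : (m : ℕ) (β : List (Fin m) → List Bool) → IsMonoidHom β →
    (f : ℕ → List (Fin m)) → (∀ n → IsPrefix (f n) (f (suc n))) →
    (n : ℕ) (k : ℤ) → (0ℚ < dyadic k n) × (dyadic k n < 1ℚ) →
    DistGt (muW β f) (dyadic k n) (inv2^ (n + 5))
mainTheorem1 m β _ f _ n k _ = Sum.map (N ,_) (N ,_)
  (blockWord-apart n (muW-blockWord β f N) (length-muW-2^ β f (n + 9)) (dyadic-isDyadic k n))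
  where
  N : ℕ
  N = 2 ^ (n + 9)
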